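{- Let $\mathcal C\subseteq\{0,1\}^n$ be a constant-weight code of length $n$, weight $w$ and minimum Hamming distance $4$, with $3\le w\le n-3$ and $2w\ne n$, and let $\mathcal C'=\mathcal C\cup\{(0,\dots,0),(1,\dots,1)\}$. Define $f:\{0,1\}^n\to\{0,1\}^n$ by, for each $i$, \[ f_i(x)=\begin{cases}1&\text{if }(1,x_{ -i})\in\mathcal C\text{ or }W(x_{ -i})\ge w+1\text{ or }\big(W(x_{ -i})=w\text{ and }(0,x_{ -i})\notin\mathcal C\big),\\ 0&\text{if }(0,x_{ -i})\in\mathcal C\text{ or }W(x_{ -i})\le w-2\text{ or }\big(W(x_{ -i})=w-1\text{ and }(1,x_{ -i})\notin\mathcal C\big).\end{cases} \] Then $f\in F(K_n^+,2)$ and $f$ converges towards $\mathcal C'$ in three steps: every element of $\mathcal C'$ is a fixed point of $f$ and $f^3(x)\in\mathcal C'$ for all $x\in\{0,1\}^n$.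
   Context: $K_n^+$ is the signed digraph on $[n]=\{0,\dots,n-1\}$ without loops having an arc $(j,i)$ for every ordered pair $j\ne i$, each signed $+1$; $F(K_n^+,2)$ is the set of maps $f:\{0,1\}^n\to\{0,1\}^n$ such that each $f_i$ does not depend on $x_i$ and is non-decreasing in every other coordinate. A constant-weight code of length $n$ and weight $w$ is a subset of $\{0,1\}^n$ all of whose elements have exactly $w$ ones; its minimum Hamming distance is the minimum number of coordinates in which two distinct codewords differ. $W(\cdot)$ is the number of ones. For $x\in\{0,1\}^n$, $x_{ -i}$ is the restriction of $x$ to coordinates other than $i$, and $(a,x_{ -i})$ is the vector obtained from $x$ by setting coordinate $i$ to $a$. -}

module Defs where

open import Data.Nat using (ℕ; zero; suc; _+_; _≤ᵇ_; _≡ᵇ_)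
open import Data.Bool using (Bool; true; false; _∨_; _∧_; not; _xor_; if_then_else_)
open import Data.Fin using (Fin)
open import Data.Vec using (Vec; []; _∷_; _[_]≔_; lookup; tabulate; zipWith)
open import Data.Bool using () renaming (_≤_ to _≤B_)
open import Relation.Binary.PropositionalEquality using (_≡_)
open import Relation.Nullary using (¬_)

-- Points of {0,1}^n (true = 1, false = 0).
Point : ℕ → Set
Point n = Vec Bool n

W : ∀ {n} → Point n → ℕ
W []           = 0
W (true  ∷ xs) = suc (W xs)
W (false ∷ xs) = W xs

dist : ∀ {n} → Point n → Point n → ℕ
dist x y = W (zipWith _xor_ x y)

-- (a, x_{-i}) : x with coordinate i set to a.
setAt : ∀ {n} → Point n → Fin n → Bool → Point n
setAt x i a = x [ i ]≔ a

-- W(x_{-i}) : number of ones of x outside coordinate i.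
W₋ : ∀ {n} → Point n → Fin n → ℕ
W₋ x i = W (setAt x i false)

Code : ℕ → Set
Code n = Point n → Bool

ConstantWeight : ∀ {n} → Code n → ℕ → Set
ConstantWeight {n} C w = ∀ (x : Point n) → C x ≡ true → W x ≡ w

MinDistance : ∀ {n} → Code n → ℕ → Set
MinDistance {n} C d =
  (∀ (x y : Point n) → C x ≡ true → C y ≡ true → ¬ x ≡ y → d Data.Nat.≤ dist x y)
  × (Σ (Point n) λ x → Σ (Point n) λ y →
       C x ≡ true × C y ≡ true × ¬ x ≡ y × dist x y ≡ d)
  where open import Data.Product using (Σ; _×_)
        import Data.Nat

InC' : ∀ {n} → Code n → Point n → Set
InC' {n} C x = C x ≡ true ⊎ x ≡ Data.Vec.replicate n false ⊎ x ≡ Data.Vec.replicate n true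
  where open import Data.Sum using (_⊎_)
        import Data.Vec

cond1 : ∀ {n} → Code n → ℕ → Point n → Fin n → Bool
cond1 C w x i =
  C (setAt x i true) ∨ (suc w ≤ᵇ W₋ x i) ∨ ((W₋ x i ≡ᵇ w) ∧ not (C (setAt x i false)))

-- Second case condition (f_i(x) = 0):
-- W(x_{-i}) ≤ w-2 is written W(x_{-i}) + 2 ≤ w, and W(x_{-i}) = w-1 as W(x_{-i}) + 1 = w.
cond0 : ∀ {n} → Code n → ℕ → Point n → Fin n → Bool
cond0 C w x i =
  C (setAt x i false) ∨ (W₋ x i + 2 ≤ᵇ w) ∨ ((suc (W₋ x i) ≡ᵇ w) ∧ not (C (setAt x i true)))

fMap : ∀ {n} → Code n → ℕ → Point n → Point n
fMap C w x = tabulate (cond1 C w x)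

-- Membership in F(K_n^+, 2): f_i does not depend on x_i and is
-- non-decreasing in every other coordinate.
InFKn+ : ∀ {n} → (Point n → Point n) → Set
InFKn+ {n} f =
  (∀ (x : Point n) (i : Fin n) (a : Bool) → lookup (f (setAt x i a)) i ≡ lookup (f x) i)
  × (∀ (x : Point n) (i j : Fin n) → ¬ j ≡ i →
       lookup (f (setAt x j false)) i ≤B lookup (f (setAt x j true)) i)
  where open import Data.Product using (_×_)

module Submission where

-- Write k = W(x_{-i}), c₁ = [(1,x_{-i}) ∈ C], c₀ = [(0,x_{-i}) ∈ C].
-- Since C has constant weight w, c₁ forces k = w - 1 and c₀ forces k = w, so
-- the rule for f_i collapses to the "local rule":
--     f_i(x) = 1 if k > w,   f_i(x) = ¬c₀ if k = w,   f_i(x) = c₁ if k < w.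
-- The two cases of the definition are then complementary, f_i ignores x_i
-- (everything is computed from x_{-i}), and monotonicity only needs that two
-- codewords agreeing outside two coordinates coincide (minimum distance ≥ 3).
-- Dynamically, f sends weight ≥ w+2 to 1ⁿ and weight ≤ w-2 to 0ⁿ; weight w+1
-- to a point with at most one zero and weight w-1 to a point with at most one
-- one (again by rigidity of the code); a codeword is fixed and a non-codeword
-- of weight w is complemented, landing on weight n-w ≠ w.  Hence every orbit
-- reaches a constant point (a fixed point) or a codeword within three steps.

open import Defs
open import Data.Nat using (ℕ; zero; suc; _≤_; _<_; _+_; _*_; _≤ᵇ_; _≡ᵇ_; _≤?_; _≟_; z≤n; s≤s; s≤s⁻¹)
open import Data.Nat.Properties
  using (≤-refl; ≤-trans; ≤-reflexive; n≤1+n; <⇒≤; <⇒≢; >⇒≢; <-cmp; m≤n⇒m<n∨m≡n; m<1+n⇒m≤n;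
         ≰⇒>; +-suc; +-comm; suc-injective; +-monoˡ-≤; <-trans; +-identityʳ; module ≤-Reasoning)
open import Data.Bool using (Bool; true; false; not; _∨_; _∧_; _xor_) renaming (_≤_ to _≤B_)
import Data.Bool.Properties as Bool
open import Data.Bool.Properties using (∨-zeroʳ; ∨-identityʳ; not-involutive; ¬-not; not-¬; xor-same)
open import Data.Fin using (Fin; zero; suc)
import Data.Fin.Properties as Fin
open import Data.Vec using ([]; _∷_; _[_]≔_; lookup; zipWith; replicate; map)
open import Data.Vec.Properties
  using (≡-dec; []≔-idempotent; []≔-commutes; []≔-lookup; lookup∘update; lookup∘update′;
         lookup∘tabulate; tabulate∘lookup; tabulate-cong; lookup-zipWith; lookup-replicate; lookup-map)
open import Data.Product using (_×_; _,_; proj₁; proj₂)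
open import Data.Sum using (_⊎_; inj₁; inj₂)
open import Relation.Binary.Definitions using (tri<; tri≈; tri>)
open import Relation.Binary.PropositionalEquality
open import Relation.Nullary using (¬_; yes; no; contradiction)
open import Relation.Nullary.Decidable using (dec-true; dec-false)
open import Function using (case_of_)

≤ᵇ-true : ∀ {m n} → m ≤ n → (m ≤ᵇ n) ≡ true
≤ᵇ-true {m} {n} = dec-true (m ≤? n)

≤ᵇ-false : ∀ {m n} → ¬ m ≤ n → (m ≤ᵇ n) ≡ false
≤ᵇ-false {m} {n} = dec-false (m ≤? n)

≡ᵇ-true : ∀ {m n} → m ≡ n → (m ≡ᵇ n) ≡ true
≡ᵇ-true {m} {n} = dec-true (m ≟ n)

≡ᵇ-false : ∀ {m n} → ¬ m ≡ n → (m ≡ᵇ n) ≡ false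
≡ᵇ-false {m} {n} = dec-false (m ≟ n)

implication⇒≤ : ∀ {a b : Bool} → (a ≡ true → b ≡ true) → a ≤B b
implication⇒≤ {false} {b} _ = Bool.≤-minimum b
implication⇒≤ {true}      h = Bool.≤-reflexive (sym (h refl))

-- Weight bookkeeping on {0,1}^n.

W-set-true : ∀ {n} (x : Point n) (i : Fin n) → W (x [ i ]≔ true) ≡ suc (W₋ x i)
W-set-true (b ∷ x)     zero    = refl
W-set-true (true ∷ x)  (suc i) = cong suc (W-set-true x i)
W-set-true (false ∷ x) (suc i) = W-set-true x i

set-self : ∀ {n} (x : Point n) (i : Fin n) {b : Bool} → lookup x i ≡ b → x [ i ]≔ b ≡ x
set-self x i xᵢ = trans (cong (x [ i ]≔_) (sym xᵢ)) ([]≔-lookup x i)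

W-at-one : ∀ {n} (x : Point n) (i : Fin n) → lookup x i ≡ true → W x ≡ suc (W₋ x i)
W-at-one x i xᵢ = trans (cong W (sym (set-self x i xᵢ))) (W-set-true x i)

W-at-zero : ∀ {n} (x : Point n) (i : Fin n) → lookup x i ≡ false → W x ≡ W₋ x i
W-at-zero x i xᵢ = cong W (sym (set-self x i xᵢ))

W₋≤W : ∀ {n} (x : Point n) (i : Fin n) → W₋ x i ≤ W x
W₋≤W x i with lookup x i in xᵢ
... | true  = ≤-trans (n≤1+n _) (≤-reflexive (sym (W-at-one x i xᵢ)))
... | false = ≤-reflexive (sym (W-at-zero x i xᵢ))

W≤1+W₋ : ∀ {n} (x : Point n) (i : Fin n) → W x ≤ suc (W₋ x i)
W≤1+W₋ x i with lookup x i in xᵢ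
... | true  = ≤-reflexive (W-at-one x i xᵢ)
... | false = ≤-trans (≤-reflexive (W-at-zero x i xᵢ)) (n≤1+n _)

W₋-raise : ∀ {n} (x : Point n) (i j : Fin n) → ¬ j ≡ i →
           W₋ (x [ j ]≔ true) i ≡ suc (W₋ (x [ j ]≔ false) i)
W₋-raise x i j j≢i = begin
  W ((x [ j ]≔ true) [ i ]≔ false)        ≡⟨ cong W ([]≔-commutes x j i j≢i) ⟩
  W ((x [ i ]≔ false) [ j ]≔ true)        ≡⟨ W-set-true (x [ i ]≔ false) j ⟩
  suc (W ((x [ i ]≔ false) [ j ]≔ false)) ≡⟨ cong (λ y → suc (W y)) ([]≔-commutes x j i j≢i) ⟨
  suc (W ((x [ j ]≔ false) [ i ]≔ false)) ∎
  where open ≡-Reasoning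

lookup-off-two : ∀ {n} (x : Point n) {i j l : Fin n} (a b : Bool) → ¬ l ≡ i → ¬ l ≡ j →
                 lookup ((x [ j ]≔ a) [ i ]≔ b) l ≡ lookup x l
lookup-off-two x a b l≢i l≢j = trans (lookup∘update′ l≢i (x [ _ ]≔ a) b) (lookup∘update′ l≢j x a)

W-all-false : ∀ {n} (y : Point n) → (∀ i → lookup y i ≡ false) → W y ≡ 0
W-all-false []          _ = refl
W-all-false (true ∷ y)  h with () ← h zero
W-all-false (false ∷ y) h = W-all-false y (λ i → h (suc i))

W-all-true : ∀ n → W (replicate n true) ≡ n
W-all-true zero    = refl
W-all-true (suc n) = cong suc (W-all-true n)

W-off-two : ∀ {n} (y : Point n) (i j : Fin n) →
            (∀ l → ¬ l ≡ i → ¬ l ≡ j → lookup y l ≡ false) → W y ≤ 2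
W-off-two y i j vanish =
  ≤-trans (W≤1+W₋ y i) (s≤s (≤-trans (W≤1+W₋ (y [ i ]≔ false) j)
    (s≤s (≤-reflexive (W-all-false ((y [ i ]≔ false) [ j ]≔ false) cleared)))))
  where
  cleared : ∀ l → lookup ((y [ i ]≔ false) [ j ]≔ false) l ≡ false
  cleared l with l Fin.≟ j | l Fin.≟ i
  ... | yes refl | _        = lookup∘update l (y [ i ]≔ false) false
  ... | no l≢j   | yes refl = trans (lookup∘update′ l≢j (y [ i ]≔ false) false) (lookup∘update l y false)
  ... | no l≢j   | no l≢i   = trans (lookup-off-two y false false l≢j l≢i) (vanish l l≢i l≢j)

W-one-one : ∀ {n} (y : Point n) →
            (∀ i j → lookup y i ≡ true → lookup y j ≡ true → i ≡ j) → W y ≤ 1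
W-one-one []          _ = z≤n
W-one-one (false ∷ y) h = W-one-one y (λ i j yᵢ yⱼ → Fin.suc-injective (h (suc i) (suc j) yᵢ yⱼ))
W-one-one (true ∷ y)  h = s≤s (≤-reflexive (W-all-false y rest-false))
  where
  rest-false : ∀ i → lookup y i ≡ false
  rest-false i = ¬-not λ yᵢ → case h zero (suc i) refl yᵢ of λ ()

W-complement : ∀ {n} (x : Point n) → W (map not x) + W x ≡ n
W-complement []          = refl
W-complement (true ∷ x)  = trans (+-suc _ _) (cong suc (W-complement x))
W-complement (false ∷ x) = cong suc (W-complement x)

-- A point with at most one 0 has weight at least n - 1 (apply the previous
-- bound to the complement).
W-one-zero : ∀ {n} (y : Point n) →
             (∀ i j → lookup y i ≡ false → lookup y j ≡ false → i ≡ j) → n ≤ suc (W y)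
W-one-zero {n} y h = begin
  n                        ≡⟨ W-complement y ⟨
  W (map not y) + W y      ≤⟨ +-monoˡ-≤ (W y) (W-one-one (map not y) complement-one-one) ⟩
  suc (W y)                ∎
  where
  open ≤-Reasoning
  zero-of-y : ∀ i → lookup (map not y) i ≡ true → lookup y i ≡ false
  zero-of-y i e = trans (sym (not-involutive _)) (cong not (trans (sym (lookup-map i not y)) e))
  complement-one-one : ∀ i j → lookup (map not y) i ≡ true → lookup (map not y) j ≡ true → i ≡ j
  complement-one-one i j a b = h i j (zero-of-y i a) (zero-of-y j b)

-- Rigidity of codes with minimum distance at least 3.

AgreeOff : ∀ {n} → Point n → Point n → Fin n → Fin n → Set
AgreeOff u v i j = ∀ l → ¬ l ≡ i → ¬ l ≡ j → lookup u l ≡ lookup v l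

dist-AgreeOff : ∀ {n} (u v : Point n) (i j : Fin n) → AgreeOff u v i j → dist u v ≤ 2
dist-AgreeOff u v i j agree = W-off-two (zipWith _xor_ u v) i j λ l l≢i l≢j → begin
  lookup (zipWith _xor_ u v) l  ≡⟨ lookup-zipWith _xor_ l u v ⟩
  lookup u l xor lookup v l     ≡⟨ cong (_xor lookup v l) (agree l l≢i l≢j) ⟩
  lookup v l xor lookup v l     ≡⟨ xor-same (lookup v l) ⟩
  false                         ∎
  where open ≡-Reasoning

Separated : ∀ {n} → Code n → Set
Separated {n} C = ∀ (u v : Point n) → C u ≡ true → C v ≡ true → ¬ u ≡ v → 3 ≤ dist u v

rigid : ∀ {n} {C : Code n} → Separated C → ∀ {u v : Point n} (i j : Fin n) →
        C u ≡ true → C v ≡ true → AgreeOff u v i j → u ≡ v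
rigid sep {u} {v} i j Cu Cv agree with ≡-dec Bool._≟_ u v
... | yes u≡v = u≡v
... | no  u≢v = contradiction (≤-trans (sep u v Cu Cv u≢v) (dist-AgreeOff u v i j agree)) λ { (s≤s (s≤s ())) }

-- If x_i ≠ b and setting coordinate i to b gives a codeword, then i is the
-- only coordinate with this property: (b,x_{-i}) and (b,x_{-j}) agree outside
-- {i, j} but differ at i.
flip-unique : ∀ {n} {C : Code n} → Separated C → ∀ (x : Point n) (b : Bool) (i j : Fin n) →
              lookup x i ≡ not b → C (x [ i ]≔ b) ≡ true → C (x [ j ]≔ b) ≡ true → i ≡ j
flip-unique sep x b i j xᵢ Cᵢ Cⱼ with i Fin.≟ j
... | yes i≡j = i≡j
... | no  i≢j = contradiction b≡not-b (not-¬ refl)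
  where
  same : x [ i ]≔ b ≡ x [ j ]≔ b
  same = rigid sep i j Cᵢ Cⱼ λ l l≢i l≢j →
    trans (lookup∘update′ l≢i x b) (sym (lookup∘update′ l≢j x b))
  b≡not-b : b ≡ not b
  b≡not-b = begin
    b                         ≡⟨ lookup∘update i x b ⟨
    lookup (x [ i ]≔ b) i     ≡⟨ cong (λ z → lookup z i) same ⟩
    lookup (x [ j ]≔ b) i     ≡⟨ lookup∘update′ i≢j x b ⟩
    lookup x i                ≡⟨ xᵢ ⟩
    not b                     ∎
    where open ≡-Reasoning

-- The local rule.  Throughout, C has constant weight w; for a point x and a
-- coordinate i we write c₁ x i and c₀ x i for the membership of (1,x_{-i}) and
-- (0,x_{-i}) in C.

module LocalRule {n : ℕ} (C : Code n) (w : ℕ) (cw : ConstantWeight C w) where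

  c₁ c₀ : Point n → Fin n → Bool
  c₁ x i = C (x [ i ]≔ true)
  c₀ x i = C (x [ i ]≔ false)

  c₁-weight : ∀ x i → c₁ x i ≡ true → suc (W₋ x i) ≡ w
  c₁-weight x i c = trans (sym (W-set-true x i)) (cw _ c)

  c₀-weight : ∀ x i → c₀ x i ≡ true → W₋ x i ≡ w
  c₀-weight x i c = cw _ c

  c₁-false : ∀ x i → ¬ suc (W₋ x i) ≡ w → c₁ x i ≡ false
  c₁-false x i k≢ = ¬-not (λ c → k≢ (c₁-weight x i c))

  c₀-false : ∀ x i → ¬ W₋ x i ≡ w → c₀ x i ≡ false
  c₀-false x i k≢ = ¬-not (λ c → k≢ (c₀-weight x i c))

  cond1-above : ∀ x i → suc w ≤ W₋ x i → cond1 C w x i ≡ true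
  cond1-above x i w<k = begin
    c₁ x i ∨ (suc w ≤ᵇ W₋ x i) ∨ ((W₋ x i ≡ᵇ w) ∧ not (c₀ x i))
      ≡⟨ cong (λ t → c₁ x i ∨ t ∨ ((W₋ x i ≡ᵇ w) ∧ not (c₀ x i))) (≤ᵇ-true w<k) ⟩
    c₁ x i ∨ true
      ≡⟨ ∨-zeroʳ (c₁ x i) ⟩
    true ∎
    where open ≡-Reasoning

  cond1-at : ∀ x i → W₋ x i ≡ w → cond1 C w x i ≡ not (c₀ x i)
  cond1-at x i k≡w = begin
    c₁ x i ∨ (suc w ≤ᵇ W₋ x i) ∨ ((W₋ x i ≡ᵇ w) ∧ not (c₀ x i))
      ≡⟨ cong₂ (λ a b → a ∨ (suc w ≤ᵇ W₋ x i) ∨ (b ∧ not (c₀ x i)))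
               (c₁-false x i (λ e → <⇒≢ ≤-refl (trans k≡w (sym e)))) (≡ᵇ-true k≡w) ⟩
    (suc w ≤ᵇ W₋ x i) ∨ not (c₀ x i)
      ≡⟨ cong (_∨ not (c₀ x i)) (≤ᵇ-false (λ w<k → <⇒≢ w<k (sym k≡w))) ⟩
    not (c₀ x i) ∎
    where open ≡-Reasoning

  cond1-below : ∀ x i → W₋ x i < w → cond1 C w x i ≡ c₁ x i
  cond1-below x i k<w = begin
    c₁ x i ∨ (suc w ≤ᵇ W₋ x i) ∨ ((W₋ x i ≡ᵇ w) ∧ not (c₀ x i))
      ≡⟨ cong₂ (λ a b → c₁ x i ∨ a ∨ (b ∧ not (c₀ x i)))
               (≤ᵇ-false (λ w<k → <⇒≢ (<-trans k<w w<k) refl)) (≡ᵇ-false (<⇒≢ k<w)) ⟩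
    c₁ x i ∨ false
      ≡⟨ ∨-identityʳ (c₁ x i) ⟩
    c₁ x i ∎
    where open ≡-Reasoning

  cond0-below : ∀ x i → suc (suc (W₋ x i)) ≤ w → cond0 C w x i ≡ true
  cond0-below x i k+2≤w = begin
    c₀ x i ∨ (W₋ x i + 2 ≤ᵇ w) ∨ ((suc (W₋ x i) ≡ᵇ w) ∧ not (c₁ x i))
      ≡⟨ cong (λ t → c₀ x i ∨ t ∨ ((suc (W₋ x i) ≡ᵇ w) ∧ not (c₁ x i)))
              (≤ᵇ-true (subst (_≤ w) (+-comm 2 (W₋ x i)) k+2≤w)) ⟩
    c₀ x i ∨ true
      ≡⟨ ∨-zeroʳ (c₀ x i) ⟩
    true ∎
    where open ≡-Reasoning

  cond0-edge : ∀ x i → suc (W₋ x i) ≡ w → cond0 C w x i ≡ not (c₁ x i)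
  cond0-edge x i k+1≡w = begin
    c₀ x i ∨ (W₋ x i + 2 ≤ᵇ w) ∨ ((suc (W₋ x i) ≡ᵇ w) ∧ not (c₁ x i))
      ≡⟨ cong₂ (λ a b → a ∨ (W₋ x i + 2 ≤ᵇ w) ∨ (b ∧ not (c₁ x i)))
               (c₀-false x i (λ k≡w → <⇒≢ ≤-refl (trans k≡w (sym k+1≡w)))) (≡ᵇ-true k+1≡w) ⟩
    (W₋ x i + 2 ≤ᵇ w) ∨ not (c₁ x i)
      ≡⟨ cong (_∨ not (c₁ x i))
              (≤ᵇ-false (λ k+2≤w → <⇒≢ (subst (_≤ w) (+-comm (W₋ x i) 2) k+2≤w) k+1≡w)) ⟩
    not (c₁ x i) ∎
    where open ≡-Reasoning

  cond0-above : ∀ x i → w ≤ W₋ x i → cond0 C w x i ≡ c₀ x i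
  cond0-above x i w≤k = begin
    c₀ x i ∨ (W₋ x i + 2 ≤ᵇ w) ∨ ((suc (W₋ x i) ≡ᵇ w) ∧ not (c₁ x i))
      ≡⟨ cong₂ (λ a b → c₀ x i ∨ a ∨ (b ∧ not (c₁ x i)))
               (≤ᵇ-false (λ k+2≤w → <⇒≢ (≤-trans (s≤s (≤-trans w≤k (n≤1+n _)))
                                             (subst (_≤ w) (+-comm (W₋ x i) 2) k+2≤w)) refl))
               (≡ᵇ-false (>⇒≢ (s≤s w≤k))) ⟩
    c₀ x i ∨ false
      ≡⟨ ∨-identityʳ (c₀ x i) ⟩
    c₀ x i ∎
    where open ≡-Reasoning

  cases-complementary : ∀ x i → cond1 C w x i ≡ not (cond0 C w x i)
  cases-complementary x i with <-cmp (suc (W₋ x i)) w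
  ... | tri< k+1<w _ _ = begin
    cond1 C w x i        ≡⟨ cond1-below x i (<⇒≤ k+1<w) ⟩
    c₁ x i               ≡⟨ c₁-false x i (<⇒≢ k+1<w) ⟩
    not true             ≡⟨ cong not (cond0-below x i k+1<w) ⟨
    not (cond0 C w x i)  ∎
    where open ≡-Reasoning
  ... | tri≈ _ k+1≡w _ = begin
    cond1 C w x i        ≡⟨ cond1-below x i (≤-reflexive k+1≡w) ⟩
    c₁ x i               ≡⟨ not-involutive (c₁ x i) ⟨
    not (not (c₁ x i))   ≡⟨ cong not (cond0-edge x i k+1≡w) ⟨
    not (cond0 C w x i)  ∎
    where open ≡-Reasoning
  ... | tri> _ _ w<k+1 with m≤n⇒m<n∨m≡n (m<1+n⇒m≤n w<k+1)
  ...   | inj₁ w<k = begin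
    cond1 C w x i        ≡⟨ cond1-above x i w<k ⟩
    not false            ≡⟨ cong not (c₀-false x i (>⇒≢ w<k)) ⟨
    not (c₀ x i)         ≡⟨ cong not (cond0-above x i (<⇒≤ w<k)) ⟨
    not (cond0 C w x i)  ∎
    where open ≡-Reasoning
  ...   | inj₂ w≡k = trans (cond1-at x i (sym w≡k)) (cong not (sym (cond0-above x i (≤-reflexive w≡k))))

  independent : ∀ x i a → lookup (fMap C w (x [ i ]≔ a)) i ≡ lookup (fMap C w x) i
  independent x i a = begin
    lookup (fMap C w (x [ i ]≔ a)) i  ≡⟨ lookup∘tabulate (cond1 C w (x [ i ]≔ a)) i ⟩
    cond1 C w (x [ i ]≔ a) i          ≡⟨ cong₂ (λ p q → C p ∨ (suc w ≤ᵇ W q) ∨ ((W q ≡ᵇ w) ∧ not (C q)))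
                                               ([]≔-idempotent x i) ([]≔-idempotent x i) ⟩
    cond1 C w x i                     ≡⟨ lookup∘tabulate (cond1 C w x) i ⟨
    lookup (fMap C w x) i             ∎
    where open ≡-Reasoning

  -- The
  -- only delicate case is f_i = 1 because (1,x_{-i}) ∈ C, so W(x_{-i}) = w - 1;
  -- after raising x_j, W(x_{-i}) = w and f_i could only be 0 if the new
  -- (0,x_{-i}) were a codeword, at distance 2 from the former one.
  raise-keeps-one : Separated C → ∀ x i j → ¬ j ≡ i →
                    cond1 C w (x [ j ]≔ false) i ≡ true → cond1 C w (x [ j ]≔ true) i ≡ true
  raise-keeps-one sep x i j j≢i one with w ≤? W₋ (x [ j ]≔ false) i
  ... | yes w≤k = cond1-above (x [ j ]≔ true) i
                    (subst (suc w ≤_) (sym (W₋-raise x i j j≢i)) (s≤s w≤k))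
  ... | no  w≰k = trans (cond1-at (x [ j ]≔ true) i k′≡w) (cong not lowered-not-codeword)
    where
    lifted-codeword : c₁ (x [ j ]≔ false) i ≡ true
    lifted-codeword = trans (sym (cond1-below (x [ j ]≔ false) i (≰⇒> w≰k))) one
    k′≡w : W₋ (x [ j ]≔ true) i ≡ w
    k′≡w = trans (W₋-raise x i j j≢i) (c₁-weight (x [ j ]≔ false) i lifted-codeword)
    lowered-not-codeword : c₀ (x [ j ]≔ true) i ≡ false
    lowered-not-codeword = ¬-not λ lowered →
      differ-at-j (cong (λ z → lookup z j) (rigid sep i j lifted-codeword lowered λ l l≢i l≢j →
        trans (lookup-off-two x false true l≢i l≢j) (sym (lookup-off-two x true false l≢i l≢j))))
      where
      at-j : ∀ a b → lookup ((x [ j ]≔ a) [ i ]≔ b) j ≡ a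
      at-j a b = trans (lookup∘update′ j≢i (x [ j ]≔ a) b) (lookup∘update j x a)
      differ-at-j : ¬ lookup ((x [ j ]≔ false) [ i ]≔ true) j ≡ lookup ((x [ j ]≔ true) [ i ]≔ false) j
      differ-at-j e with () ← trans (sym (at-j false true)) (trans e (at-j true false))

  monotone : Separated C → ∀ x i j → ¬ j ≡ i →
             lookup (fMap C w (x [ j ]≔ false)) i ≤B lookup (fMap C w (x [ j ]≔ true)) i
  monotone sep x i j j≢i =
    subst₂ _≤B_ (sym (lookup∘tabulate _ i)) (sym (lookup∘tabulate _ i))
      (implication⇒≤ (raise-keeps-one sep x i j j≢i))

-- One step of f on each weight class, for a separated constant-weight code.

module Dynamics {n : ℕ} (C : Code n) (w : ℕ) (cw : ConstantWeight C w) (sep : Separated C) where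

  open LocalRule C w cw

  f : Point n → Point n
  f = fMap C w

  f-coord : ∀ x i → lookup (f x) i ≡ cond1 C w x i
  f-coord x i = lookup∘tabulate (cond1 C w x) i

  f-≡ : ∀ x (v : Point n) → (∀ i → cond1 C w x i ≡ lookup v i) → f x ≡ v
  f-≡ x v h = trans (tabulate-cong h) (tabulate∘lookup v)

  -- Weight ≥ w + 2: every W(x_{-i}) exceeds w, so f(x) = 1ⁿ.
  heavy-to-ones : ∀ x → suc (suc w) ≤ W x → f x ≡ replicate n true
  heavy-to-ones x heavy = f-≡ x _ λ i →
    trans (cond1-above x i (s≤s⁻¹ (≤-trans heavy (W≤1+W₋ x i)))) (sym (lookup-replicate i true))

  -- Weight ≤ w - 2: every W(x_{-i}) + 1 is below w, so f(x) = 0ⁿ.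
  light-to-zeros : ∀ x → suc (suc (W x)) ≤ w → f x ≡ replicate n false
  light-to-zeros x light = f-≡ x _ λ i →
    trans (cond1-below x i (≤-trans (s≤s (≤-trans (W₋≤W x i) (n≤1+n _))) light))
      (trans (c₁-false x i (<⇒≢ (≤-trans (s≤s (s≤s (W₋≤W x i))) light)))
        (sym (lookup-replicate i false)))

  -- Weight w + 1: a zero of f(x) sits at a one of x whose removal gives a
  -- codeword; by rigidity there is at most one such coordinate.
  near-heavy : ∀ x → W x ≡ suc w → n ≤ suc (W (f x))
  near-heavy x wx = W-one-zero (f x) λ i j zᵢ zⱼ →
    flip-unique sep x false i j (proj₁ (zero-of i zᵢ)) (proj₂ (zero-of i zᵢ)) (proj₂ (zero-of j zⱼ))
    where
    zero-of : ∀ i → lookup (f x) i ≡ false → lookup x i ≡ true × c₀ x i ≡ true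
    zero-of i fᵢ with lookup x i in xᵢ
    ... | false with () ← trans (sym (cond1-above x i (≤-reflexive (trans (sym wx) (W-at-zero x i xᵢ)))))
                                (trans (sym (f-coord x i)) fᵢ)
    ... | true  = refl , Bool.not-injective (trans (sym (cond1-at x i k≡w)) (trans (sym (f-coord x i)) fᵢ))
      where
      k≡w : W₋ x i ≡ w
      k≡w = suc-injective (trans (sym (W-at-one x i xᵢ)) wx)

  -- Weight w - 1: symmetrically, a one of f(x) sits at a zero of x whose
  -- raising gives a codeword, and there is at most one such coordinate.
  near-light : ∀ x → suc (W x) ≡ w → W (f x) ≤ 1
  near-light x wx = W-one-one (f x) λ i j oᵢ oⱼ →
    flip-unique sep x true i j (proj₁ (one-of i oᵢ)) (proj₂ (one-of i oᵢ)) (proj₂ (one-of j oⱼ))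
    where
    x-not-codeword : C x ≡ false
    x-not-codeword = ¬-not λ Cx → <⇒≢ (≤-reflexive wx) (cw x Cx)
    below-w : ∀ i → W₋ x i < w
    below-w i = ≤-trans (s≤s (W₋≤W x i)) (≤-reflexive wx)
    one-of : ∀ i → lookup (f x) i ≡ true → lookup x i ≡ false × c₁ x i ≡ true
    one-of i fᵢ with lookup x i in xᵢ
    ... | true  with () ← trans (sym fᵢ) (trans (f-coord x i) (trans (cond1-below x i (below-w i))
                            (trans (cong C (set-self x i xᵢ)) x-not-codeword)))
    ... | false = refl , trans (sym (cond1-below x i (below-w i))) (trans (sym (f-coord x i)) fᵢ)

  balanced-at-one : ∀ x i → W x ≡ w → lookup x i ≡ true → cond1 C w x i ≡ C x
  balanced-at-one x i wx xᵢ =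
    trans (cond1-below x i (≤-reflexive (trans (sym (W-at-one x i xᵢ)) wx))) (cong C (set-self x i xᵢ))

  balanced-at-zero : ∀ x i → W x ≡ w → lookup x i ≡ false → cond1 C w x i ≡ not (C x)
  balanced-at-zero x i wx xᵢ =
    trans (cond1-at x i (trans (sym (W-at-zero x i xᵢ)) wx)) (cong (λ y → not (C y)) (set-self x i xᵢ))

  codeword-fixed : ∀ x → C x ≡ true → f x ≡ x
  codeword-fixed x Cx = f-≡ x x λ i → fixed-at i
    where
    fixed-at : ∀ i → cond1 C w x i ≡ lookup x i
    fixed-at i with lookup x i in xᵢ
    ... | true  = trans (balanced-at-one x i (cw x Cx) xᵢ) Cx
    ... | false = trans (balanced-at-zero x i (cw x Cx) xᵢ) (cong not Cx)

  balanced-complemented : ∀ x → W x ≡ w → C x ≡ false → f x ≡ map not x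
  balanced-complemented x wx Cx = f-≡ x (map not x) λ i →
    trans (flipped-at i) (sym (lookup-map i not x))
    where
    flipped-at : ∀ i → cond1 C w x i ≡ not (lookup x i)
    flipped-at i with lookup x i in xᵢ
    ... | true  = trans (balanced-at-one x i wx xᵢ) Cx
    ... | false = trans (balanced-at-zero x i wx xᵢ) (cong not Cx)

-- Convergence, under the size conditions 3 ≤ w, w + 3 ≤ n and 2w ≠ n.

module Convergence {n : ℕ} (C : Code n) (w : ℕ) (cw : ConstantWeight C w) (sep : Separated C)
                   (3≤w : 3 ≤ w) (w+3≤n : w + 3 ≤ n) (2w≢n : ¬ 2 * w ≡ n) where

  open Dynamics C w cw sep

  IsConstant : Point n → Set
  IsConstant y = y ≡ replicate n false ⊎ y ≡ replicate n true

  w+2<n : suc (suc w) < n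
  w+2<n = subst (_≤ n) (+-comm w 3) w+3≤n

  constant-fixed : ∀ y → IsConstant y → f y ≡ y
  constant-fixed y (inj₁ refl) = light-to-zeros _
    (subst (λ t → suc (suc t) ≤ w) (sym (W-all-false (replicate n false) λ i → lookup-replicate i false)) (<⇒≤ 3≤w))
  constant-fixed y (inj₂ refl) = heavy-to-ones _
    (subst (suc (suc w) ≤_) (sym (W-all-true n)) (<⇒≤ w+2<n))

  settles-in-two : ∀ x → ¬ W x ≡ w → IsConstant (f (f x))
  settles-in-two x W≢w with <-cmp (W x) w
  ... | tri≈ _ W≡w _ = contradiction W≡w W≢w
  ... | tri< W<w _ _ with m≤n⇒m<n∨m≡n W<w
  ...   | inj₁ light = inj₁ (trans (cong f (light-to-zeros x light)) (constant-fixed _ (inj₁ refl)))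
  ...   | inj₂ W+1≡w = inj₁ (light-to-zeros (f x) (≤-trans (s≤s (s≤s (near-light x W+1≡w))) 3≤w))
  settles-in-two x W≢w | tri> _ _ w<W with m≤n⇒m<n∨m≡n w<W
  ...   | inj₁ heavy = inj₂ (trans (cong f (heavy-to-ones x heavy)) (constant-fixed _ (inj₂ refl)))
  ...   | inj₂ w+1≡W = inj₂ (heavy-to-ones (f x) (s≤s⁻¹ (≤-trans w+2<n (near-heavy x (sym w+1≡W)))))

  complement-off-w : ∀ x → W x ≡ w → ¬ W (map not x) ≡ w
  complement-off-w x wx wc = 2w≢n (begin
    2 * w              ≡⟨ cong (w +_) (+-identityʳ w) ⟩
    w + w              ≡⟨ cong₂ _+_ wc wx ⟨
    W (map not x) + W x ≡⟨ W-complement x ⟩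
    n                  ∎)
    where open ≡-Reasoning

  fixed-points : ∀ x → InC' C x → f x ≡ x
  fixed-points x (inj₁ Cx)       = codeword-fixed x Cx
  fixed-points x (inj₂ constant) = constant-fixed x constant

  constant-in-C' : ∀ y → IsConstant y → InC' C y
  constant-in-C' y constant = inj₂ constant

  -- f³(x) ∈ C': off weight w, or on weight w outside C after one
  -- complementing step, two steps reach a constant point; codewords stay put.
  three-steps : ∀ x → InC' C (f (f (f x)))
  three-steps x with W x ≟ w | C x in Cx
  ... | no W≢w | _ =
    constant-in-C' _ (subst IsConstant (sym (constant-fixed _ (settles-in-two x W≢w))) (settles-in-two x W≢w))
  ... | yes W≡w | true  = inj₁ (trans (cong C (trans (cong (λ y → f (f y)) (codeword-fixed x Cx))
                                  (trans (cong f (codeword-fixed x Cx)) (codeword-fixed x Cx)))) Cx)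
  ... | yes W≡w | false = constant-in-C' _ (settles-in-two (f x)
    (subst (λ y → ¬ W y ≡ w) (sym (balanced-complemented x W≡w Cx)) (complement-off-w x W≡w)))

proposition8 : (n w : ℕ) (C : Code n)
    → ConstantWeight C w
    → MinDistance C 4
    → 3 ≤ w → w + 3 ≤ n → ¬ (2 * w ≡ n)
    → (∀ (x : Point n) (i : Fin n) → cond1 C w x i ≡ not (cond0 C w x i))
      × InFKn+ (fMap C w)
      × (∀ (x : Point n) → InC' C x → fMap C w x ≡ x)
      × (∀ (x : Point n) → InC' C (fMap C w (fMap C w (fMap C w x))))
proposition8 n w C cw md 3≤w w+3≤n 2w≢n =
  cases-complementary , (independent , monotone sep) , fixed-points , three-steps
  where
  sep : Separated C
  sep u v Cu Cv u≢v = ≤-trans (n≤1+n 3) (proj₁ md u v Cu Cv u≢v)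
  open LocalRule C w cw
  open Convergence C w cw sep 3≤w w+3≤n 2w≢n
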